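{- Let $X$ be an access sequence with one access per time step, $T$ an initial tree, and $G(X)=G_T(X)$. Suppose there are keys $a<b$ and times $t_1<t_2$ such that $(b,t_2)\in G(X)\setminus X$ and $(a,t_1)\in G(X)$ (either $(a,t_1)\in G(X)\setminus X$ or $(a,t_1)\in X$). Then $X$ contains a point in the region $[a+1,\infty)\times[t_1+1,t_2]$. Symmetrically, if $(a,t_2)\in G(X)\setminus X$ and $(b,t_1)\in G(X)$, then $X$ contains a point in $(-\infty,b-1]\times[t_1+1,t_2]$.
   Context: The access sequence $X=(x_1,\dots,x_m)$ is identified with the point set $\{(x_t,t)\}$ (key = column, time = row). Geometric Greedy: the initial BST $T$ on $[n]$ is encoded by a fixed point set in rows $-(n-1),\dots,0$ (standard geometric encoding; each column contains a point). For $t=1,\dots,m$: with $p=(x_t,t)$ and, for each key $a$, $q=(a,\tau(a,t))$ where $\tau(a,t)$ is the last row $<t$ with a point in column $a$, add $(a,t)$ iff the closed rectangle with corners $p,q$ contains no point other than $p,q$. $G_T(X)$ is the set of points added in rows $1,\dots,m$; it contains $X$. -}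

module Defs where

open import Data.Nat as ℕ using (ℕ; zero; suc; _+_; _<_; _≤_; _<ᵇ_; _≡ᵇ_)
open import Data.Nat.Base using (_⊔_; _⊓_)
open import Data.Integer as ℤ using (ℤ; +_; -_)
open import Data.Bool using (Bool; true; false; if_then_else_; _∧_; not; T?)
open import Data.Bool.ListAction using (any)
open import Data.List using (List; []; _∷_; map; filter; foldr; upTo; length; lookup; _++_)
open import Data.List.Membership.Propositional using (_∈_)
open import Data.Maybe using (Maybe; just; nothing)
open import Data.Product using (_×_; _,_; Σ)
open import Data.Fin using (Fin; toℕ)
open import Relation.Binary.PropositionalEquality using (_≡_)
open import Relation.Nullary.Decidable using (⌊_⌋)

data Tree : Set where
  leaf : Tree
  node : Tree → ℕ → Tree → Tree

-- BSTon lo k t : t is a binary search tree whose key set is exactly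
-- {lo, lo+1, ..., lo+k-1}, in symmetric (in-)order.
data BSTon : ℕ → ℕ → Tree → Set where
  leaf : ∀ {lo} → BSTon lo 0 leaf
  node : ∀ {lo i j l r} → BSTon lo i l → BSTon (lo + i + 1) j r →
         BSTon lo (i + 1 + j) (node l (lo + i) r)

BST : ℕ → Tree → Set
BST n t = BSTon 1 n t

depth : Tree → ℕ → ℕ
depth leaf a = 0
depth (node l k r) a =
  if a <ᵇ k then suc (depth l a)
  else if a ≡ᵇ k then 0
  else suc (depth r a)

-- Points: (key = column, time = row).
Pt : Set
Pt = ℕ × ℤ

keys : ℕ → List ℕ
keys n = map suc (upTo n)

-- Geometric encoding of the initial tree: key a gets the point (a, -depth_T(a)),
-- so rows lie in -(n-1),...,0 and each column contains exactly one point.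
initPts : ℕ → Tree → List Pt
initPts n T = map (λ a → a , - (+ depth T a)) (keys n)

lastRow : List Pt → ℕ → Maybe ℤ
lastRow ps a = foldr f nothing ps
  where
  f : Pt → Maybe ℤ → Maybe ℤ
  f (c , r) acc with ⌊ c ℕ.≟ a ⌋
  ... | false = acc
  ... | true with acc
  ...   | nothing = just r
  ...   | just s = just (r ℤ.⊔ s)

-- Does some point of ps, other than q = (a , τ), lie in the closed rectangle
-- spanned by (x , t) and (a , τ)?  (All points of ps lie in rows < t, and
-- p = (x , t) itself is not in ps.)
blocked : List Pt → ℕ → ℤ → ℕ → ℤ → Bool
blocked ps x t a τ = any inRect ps
  where
  inRect : Pt → Bool
  inRect (c , r) =
    ((x ⊓ a) ℕ.≤ᵇ c) ∧ (c ℕ.≤ᵇ (x ⊔ a)) ∧ (τ ℤ.≤ᵇ r) ∧ (r ℤ.≤ᵇ t) ∧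
    not ((c ≡ᵇ a) ∧ ⌊ r ℤ.≟ τ ⌋)

addKey : List Pt → ℕ → ℤ → ℕ → Bool
addKey ps x t a with lastRow ps a
... | nothing = false
... | just τ = not (blocked ps x t a τ)

newRow : ℕ → List Pt → ℕ → ℤ → List Pt
newRow n ps x t = map (λ a → a , t) (filter (λ a → T? (addKey ps x t a)) (keys n))

run : ℕ → List Pt → ℕ → List ℕ → List Pt
run n ps t [] = ps
run n ps t (x ∷ xs) = run n (ps ++ newRow n ps x (+ t)) (suc t) xs

allPts : ℕ → Tree → List ℕ → List Pt
allPts n T X = run n (initPts n T) 1 X

InG : ℕ → Tree → List ℕ → ℕ → ℕ → Set
InG n T X a t = (1 ≤ t) × ((a , + t) ∈ allPts n T X)

-- (a , t) ∈ X, i.e. x_t = a (times are 1-indexed).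
InX : List ℕ → ℕ → ℕ → Set
InX X a t = Σ (Fin (length X)) λ i → (suc (toℕ i) ≡ t) × (lookup X i ≡ a)

ValidSeq : ℕ → List ℕ → Set
ValidSeq n X = ∀ {x} → x ∈ X → (1 ≤ x) × (x ≤ n)

module Submission where

-- Let (y , t₂) ∈ G ∖ X and (z , t₁) ∈ G with t₁ < t₂, and call a key good when it lies strictly
-- on y's side of z.  If the key x accessed at time t₂ is not good, z lies between x and y, so
-- (z , t₁) is in the rectangle spanned by (x , t₂) and the previous point (y , τ) of column y
-- unless τ > t₁.  Greedy added (y , t₂), so that rectangle was empty: hence t₁ < τ < t₂ and
-- (y , τ) ∈ G.  Either (y , τ) ∈ X, an access of the good key y, or the argument repeats from
-- (y , τ).

open import Defs
open import Data.Nat as ℕ using (ℕ; zero; suc; _+_; _∸_; _<_; _≤_; _⊔_; _⊓_)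
import Data.Nat.Properties as ℕ
open import Data.Nat.Induction using (<-rec)
open import Data.Integer as ℤ using (ℤ; +_; +<+; +≤+)
import Data.Integer.Properties as ℤ
open import Data.Bool using (true; false; T; not; _∧_; T?)
open import Data.Bool.Properties using (T-∧; T-not-≡)
open import Data.List using (List; []; _∷_; foldr; length; lookup; _++_)
open import Data.List.Membership.Propositional using (_∈_; lose)
open import Data.List.Membership.Propositional.Properties using (∈-map⁻; ∈-filter⁻; ∈-++⁻; ∈-++⁺ˡ)
open import Data.List.Relation.Unary.Any using (here; there)
open import Data.List.Relation.Unary.Any.Properties using (any⁺)
open import Data.Maybe using (Maybe; just; nothing)
open import Data.Product using (_×_; _,_; ∃₂; ∃-syntax; Σ; proj₁; proj₂)
open import Data.Sum using (_⊎_; inj₁; inj₂)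
open import Data.Fin using (Fin; toℕ)
import Data.Fin.Properties as Fin
open import Data.Empty using (⊥-elim)
open import Function using (_∘_)
open import Function.Bundles using (Equivalence)
open import Induction.WellFounded using (WfRec)
open import Relation.Binary.PropositionalEquality using (_≡_; _≢_; refl; sym; trans; subst)
open import Relation.Nullary using (¬_; Dec; yes; no; _×-dec_)
open import Relation.Unary using (Decidable)

RowsBelow : List Pt → ℕ → Set
RowsBelow ps t = ∀ {c r} → (c , r) ∈ ps → r ℤ.< + t

∈-newRow⁻ : ∀ n ps x t {c r} → (c , r) ∈ newRow n ps x t → r ≡ t × T (addKey ps x t c)
∈-newRow⁻ n ps x t c∈ with ∈-map⁻ (λ a → a , t) c∈
... | a , a∈ , refl = refl , proj₂ (∈-filter⁻ (λ a → T? (addKey ps x t a)) {xs = keys n} a∈)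

step-rowsBelow : ∀ n ps x t → RowsBelow ps t → RowsBelow (ps ++ newRow n ps x (+ t)) (suc t)
step-rowsBelow n ps x t rows p∈ with ∈-++⁻ ps p∈
... | inj₁ p∈ps = ℤ.<-trans (rows p∈ps) (+<+ (ℕ.n<1+n t))
... | inj₂ p∈new with ∈-newRow⁻ n ps x (+ t) p∈new
...   | refl , _ = +<+ (ℕ.n<1+n t)

run-rowsBelow : ∀ n ps t xs → RowsBelow ps t → RowsBelow (run n ps t xs) (t + length xs)
run-rowsBelow n ps t [] rows = subst (λ u → RowsBelow ps u) (sym (ℕ.+-identityʳ t)) rows
run-rowsBelow n ps t (x ∷ xs) rows =
  subst (λ u → RowsBelow (run n ps t (x ∷ xs)) u) (sym (ℕ.+-suc t (length xs)))
        (run-rowsBelow n _ (suc t) xs (step-rowsBelow n ps x t rows))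

∈-run⁺ : ∀ n ps t xs {p} → p ∈ ps → p ∈ run n ps t xs
∈-run⁺ n ps t [] p∈ = p∈
∈-run⁺ n ps t (x ∷ xs) p∈ = ∈-run⁺ n _ (suc t) xs (∈-++⁺ˡ p∈)

∈-run-below : ∀ n ps t xs {c r} → (c , r) ∈ run n ps t xs → r ℤ.< + t → (c , r) ∈ ps
∈-run-below n ps t [] p∈ r<t = p∈
∈-run-below n ps t (x ∷ xs) p∈ r<t
  with ∈-++⁻ ps (∈-run-below n _ (suc t) xs p∈ (ℤ.<-trans r<t (+<+ (ℕ.n<1+n t))))
... | inj₁ p∈ps = p∈ps
... | inj₂ p∈new with ∈-newRow⁻ n ps x (+ t) p∈new
...   | refl , _ = ⊥-elim (ℤ.<-irrefl refl r<t)

record Snapshot (n : ℕ) (ps : List Pt) (t : ℕ) (xs : List ℕ) (s : ℕ) : Set where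
  field
    index      : Fin (length xs)
    index-row  : t + toℕ index ≡ s
    state      : List Pt
    state-rows : RowsBelow state s
    state-⊆    : ∀ {p} → p ∈ state → p ∈ run n ps t xs
    below-⊆    : ∀ {c r} → (c , r) ∈ run n ps t xs → r ℤ.< + s → (c , r) ∈ state
    row-added  : ∀ {c} → (c , + s) ∈ run n ps t xs → T (addKey state (lookup xs index) (+ s) c)

  access : ℕ
  access = lookup xs index

snapshot : ∀ n ps t xs s → RowsBelow ps t → t ≤ s → s < t + length xs → Snapshot n ps t xs s
snapshot n ps t [] s rows t≤s s<t+0 =
  ⊥-elim (ℕ.<⇒≱ (subst (s <_) (ℕ.+-identityʳ t) s<t+0) t≤s)
snapshot n ps t (x ∷ xs) s rows t≤s s<end with ℕ.m≤n⇒m<n∨m≡n t≤s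
... | inj₂ refl = record
  { index      = Fin.zero
  ; index-row  = ℕ.+-identityʳ t
  ; state      = ps
  ; state-rows = rows
  ; state-⊆    = ∈-run⁺ n ps t (x ∷ xs)
  ; below-⊆    = ∈-run-below n ps t (x ∷ xs)
  ; row-added  = added
  }
  where
  added : ∀ {c} → (c , + t) ∈ run n ps t (x ∷ xs) → T (addKey ps x (+ t) c)
  added c∈ with ∈-++⁻ ps (∈-run-below n _ (suc t) xs c∈ (+<+ (ℕ.n<1+n t)))
  ... | inj₁ c∈ps  = ⊥-elim (ℤ.<-irrefl refl (rows c∈ps))
  ... | inj₂ c∈new = proj₂ (∈-newRow⁻ n ps x (+ t) c∈new)
... | inj₁ t<s = record
  { index      = Fin.suc index
  ; index-row  = trans (ℕ.+-suc t (toℕ index)) index-row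
  ; state      = state
  ; state-rows = state-rows
  ; state-⊆    = state-⊆
  ; below-⊆    = below-⊆
  ; row-added  = row-added
  }
  where
  open Snapshot (snapshot n _ (suc t) xs s (step-rowsBelow n ps x t rows) t<s
                          (subst (s <_) (ℕ.+-suc t (length xs)) s<end))

initPts-rowsBelow : ∀ n T₀ → RowsBelow (initPts n T₀) 1
initPts-rowsBelow n T₀ p∈ with ∈-map⁻ (λ a → a , ℤ.- (+ depth T₀ a)) p∈
... | a , _ , refl with depth T₀ a
...   | zero  = +<+ ℕ.z<s
...   | suc _ = ℤ.-<+

rowSnapshot : ∀ n T₀ X {c t} → InG n T₀ X c t → Snapshot n (initPts n T₀) 1 X t
rowSnapshot n T₀ X (1≤t , c∈) =
  snapshot n (initPts n T₀) 1 X _ (initPts-rowsBelow n T₀) 1≤t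
           (ℤ.drop‿+<+ (run-rowsBelow n (initPts n T₀) 1 X (initPts-rowsBelow n T₀) c∈))

-- `lastRow` folds with a function local to its where block; unification recovers it, so that
-- `lastRow` can be unfolded one list element at a time.
lastRowStep : List Pt → ℕ → Pt → Maybe ℤ → Maybe ℤ
lastRowStep ps a = proj₁ asFoldr
  where
  asFoldr : Σ (Pt → Maybe ℤ → Maybe ℤ) λ f → lastRow ps a ≡ foldr f nothing ps
  asFoldr = _ , refl

foldr-lastRowStep-∈ : ∀ ps a qs {τ} → foldr (lastRowStep ps a) nothing qs ≡ just τ → (a , τ) ∈ qs
foldr-lastRowStep-∈ ps a [] ()
foldr-lastRowStep-∈ ps a ((c , r) ∷ qs) eq with c ℕ.≟ a
... | no _ = there (foldr-lastRowStep-∈ ps a qs eq)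
... | yes refl with foldr (lastRowStep ps a) nothing qs in eq′
...   | nothing with eq
...     | refl = here refl
foldr-lastRowStep-∈ ps a ((c , r) ∷ qs) refl | yes refl | just s with ℤ.⊔-sel r s
... | inj₁ r⊔s≡r rewrite r⊔s≡r = here refl
... | inj₂ r⊔s≡s rewrite r⊔s≡s = there (foldr-lastRowStep-∈ ps a qs eq′)

lastRow-∈ : ∀ ps a {τ} → lastRow ps a ≡ just τ → (a , τ) ∈ ps
lastRow-∈ ps a = foldr-lastRowStep-∈ ps a ps

T-∧-intro : ∀ {b c} → T b → T c → T (b ∧ c)
T-∧-intro tb tc = Equivalence.from T-∧ (tb , tc)

T-not-∧ˡ : ∀ {b} c → ¬ T b → T (not (b ∧ c))
T-not-∧ˡ {false} _ _  = _
T-not-∧ˡ {true}  _ ¬b = ⊥-elim (¬b _)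

addKey⇒column-above : ∀ {ps x t y z r} → T (addKey ps x t y) → (z , r) ∈ ps →
  x ⊓ y ≤ z → z ≤ x ⊔ y → z ≢ y → r ℤ.≤ t → ∃[ τ ] (y , τ) ∈ ps × r ℤ.< τ
addKey⇒column-above {ps} {x} {t} {y} {z} {r} added z∈ lo hi z≢y r≤t with lastRow ps y in last
... | just τ with τ ℤ.≤? r
...   | no τ≰r = τ , lastRow-∈ ps y last , ℤ.≰⇒> τ≰r
...   | yes τ≤r = ⊥-elim (subst T (Equivalence.to T-not-≡ added) blocks)
  where
  blocks : T (blocked ps x t y τ)
  blocks = any⁺ _ (lose z∈
    (T-∧-intro (ℕ.≤⇒≤ᵇ lo) (T-∧-intro (ℕ.≤⇒≤ᵇ hi) (T-∧-intro (ℤ.≤⇒≤ᵇ τ≤r)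
      (T-∧-intro (ℤ.≤⇒≤ᵇ r≤t) (T-not-∧ˡ _ (z≢y ∘ ℕ.≡ᵇ⇒≡ z y)))))))

InX? : ∀ X c t → Dec (InX X c t)
InX? X c t = Fin.any? (λ i → (suc (toℕ i) ℕ.≟ t) ×-dec (lookup X i ℕ.≟ c))

AccessIn : List ℕ → (ℕ → Set) → ℕ → ℕ → Set
AccessIn X Good t₁ t₂ = ∃₂ λ c t → InX X c t × Good c × t₁ + 1 ≤ t × t ≤ t₂

<⇒+1≤ : ∀ {m n} → m < n → m + 1 ≤ n
<⇒+1≤ {m} {n} m<n = subst (_≤ n) (ℕ.+-comm 1 m) m<n

module _ (n : ℕ) (T₀ : Tree) (X : List ℕ) {Good : ℕ → Set} (good? : Decidable Good)
         {y z : ℕ} (good-y : Good y) (z≢y : z ≢ y)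
         (between : ∀ {x} → ¬ Good x → x ⊓ y ≤ z × z ≤ x ⊔ y) where

  earlier-touch : ∀ {t₁ t₂} → InG n T₀ X z t₁ → t₁ < t₂ → InG n T₀ X y t₂ →
    AccessIn X Good t₁ t₂ ⊎ ∃[ s ] t₁ < s × s < t₂ × InG n T₀ X y s
  earlier-touch {t₁} {t₂} (_ , z∈) t₁<t₂ y∈G@(_ , y∈) = by-access (good? access)
    where
    S = rowSnapshot n T₀ X y∈G
    open Snapshot S

    by-access : Dec (Good access) → AccessIn X Good t₁ t₂ ⊎ ∃[ s ] t₁ < s × s < t₂ × InG n T₀ X y s
    by-access (yes good-x) =
      inj₁ (access , t₂ , (index , index-row , refl) , good-x , <⇒+1≤ t₁<t₂ , ℕ.≤-refl)
    by-access (no ¬good-x)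
      with addKey⇒column-above (row-added y∈) (below-⊆ z∈ (+<+ t₁<t₂))
             (proj₁ (between ¬good-x)) (proj₂ (between ¬good-x)) z≢y (+≤+ (ℕ.<⇒≤ t₁<t₂))
    ... | + s , y∈state , +<+ t₁<s =
      inj₂ (s , t₁<s , ℤ.drop‿+<+ (state-rows y∈state) , ℕ.<-≤-trans ℕ.z<s t₁<s , state-⊆ y∈state)

  strip-access : ∀ {t₁ t₂} → InG n T₀ X z t₁ → t₁ < t₂ → InG n T₀ X y t₂ → ¬ InX X y t₂ →
    AccessIn X Good t₁ t₂
  strip-access {t₁} {t₂} z∈G = <-rec Claim descend t₂
    where
    Claim : ℕ → Set
    Claim u = t₁ < u → InG n T₀ X y u → ¬ InX X y u → AccessIn X Good t₁ u

    descend : ∀ u → WfRec _<_ Claim u → Claim u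
    descend u earlier t₁<u y∈G y∉X with earlier-touch z∈G t₁<u y∈G
    ... | inj₁ access = access
    ... | inj₂ (s , t₁<s , s<u , y∈G′) with InX? X y s
    ...   | yes y∈X = y , s , y∈X , good-y , <⇒+1≤ t₁<s , ℕ.<⇒≤ s<u
    ...   | no y∉X′ with earlier s<u t₁<s y∈G′ y∉X′
    ...     | c , t , c∈X , good-c , t₁<t , t≤s =
      c , t , c∈X , good-c , t₁<t , ℕ.≤-trans t≤s (ℕ.<⇒≤ s<u)

mainTheorem12 : (n : ℕ) (T : Tree) → BST n T → (X : List ℕ) → ValidSeq n X →
    (a b t₁ t₂ : ℕ) → a < b → t₁ < t₂ →
      ((InG n T X b t₂ × ¬ InX X b t₂ × InG n T X a t₁) →
        ∃₂ λ c t → InX X c t × a + 1 ≤ c × t₁ + 1 ≤ t × t ≤ t₂)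
    × ((InG n T X a t₂ × ¬ InX X a t₂ × InG n T X b t₁) →
        ∃₂ λ c t → InX X c t × c ≤ b ∸ 1 × t₁ + 1 ≤ t × t ≤ t₂)
mainTheorem12 n T _ X _ a (suc b′) t₁ t₂ a<b t₁<t₂ =
    (λ (b∈G , b∉X , a∈G) →
       strip-access n T X (λ c → a + 1 ℕ.≤? c) (<⇒+1≤ a<b) (ℕ.<⇒≢ a<b) right-between a∈G t₁<t₂ b∈G b∉X)
  , (λ (a∈G , a∉X , b∈G) →
       strip-access n T X (ℕ._≤? b′) (ℕ.≤-pred a<b) (ℕ.<⇒≢ a<b ∘ sym) left-between b∈G t₁<t₂ a∈G a∉X)
  where
  right-between : ∀ {x} → ¬ a + 1 ≤ x → x ⊓ suc b′ ≤ a × a ≤ x ⊔ suc b′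
  right-between {x} a≮x =
      ℕ.≤-trans (ℕ.m⊓n≤m x _) (ℕ.≤-pred (subst (x <_) (ℕ.+-comm a 1) (ℕ.≰⇒> a≮x)))
    , ℕ.≤-trans (ℕ.<⇒≤ a<b) (ℕ.m≤n⊔m x _)

  left-between : ∀ {x} → ¬ x ≤ b′ → x ⊓ a ≤ suc b′ × suc b′ ≤ x ⊔ a
  left-between {x} x≰b′ = ℕ.≤-trans (ℕ.m⊓n≤n x a) (ℕ.<⇒≤ a<b) , ℕ.≤-trans (ℕ.≰⇒> x≰b′) (ℕ.m≤m⊔n x a)
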